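{- For the elementary cellular automaton $F_{156}$ and every nonempty finite word $u\in\{0,1\}^*$, $D(\textsc{SInv}_{F_{156},u,n})\in O(1)$ as $n\to\infty$.
   Context: The ECA with Wolfram number $N$ is $F_N:\{0,1\}^{\mathbb{Z}}\to\{0,1\}^{\mathbb{Z}}$, $(F_N(x))_i=f_N(x_{i-1},x_i,x_{i+1})$, where $f_N(a,b,c)$ is the bit of index $4a+2b+c$ of $N$ in binary. For a nonempty word $u$, $p_u\in\{0,1\}^{\mathbb{Z}}$ is $(p_u)_i=u_{i\bmod |u|}$; for a finite word $x$, $p_u[x]$ equals $x$ on positions $\{0,\dots,|x|-1\}$ and $p_u$ elsewhere. $\textsc{SInv}_{F,u,n}:\{0,1\}^n\to\{0,1\}$ maps $x$ to $1$ iff there is an integer $w$ such that for every $t\ge 0$ the set of positions where $F^t(p_u)$ and $F^t(p_u[x])$ differ is contained in an interval of length $w$. For finite sets $X,Y,Z$ and $g:X\times Y\to Z$, $D(g)$ is the minimal depth of a deterministic two-party communication protocol tree computing $g$ (Alice knows $x$, Bob knows $y$; internal nodes are labelled by a function of $x$ alone or of $y$ alone to $\{\mathrm{l},\mathrm{r}\}$, leaves by outputs). For $g:\{0,1\}^m\to Z$, $D(g)=\max_{0\le i\le m} D(g_i)$ with $g_i(x,y)=g(xy)$ for $x\in\{0,1\}^i$, $y\in\{0,1\}^{m-i}$. -}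

module Defs where

open import Data.Bool using (Bool; true; false; if_then_else_)
open import Data.Nat as ℕ using (ℕ; zero; suc; _⊔_)
open import Data.Nat.DivMod using (_/_; _%_)
open import Data.Integer as ℤ using (ℤ; +_; -[1+_])
open import Data.Integer.DivMod using (_%ℕ_; n%ℕd<d)
open import Data.Fin using (Fin; fromℕ<)
open import Data.Vec using (Vec; lookup; _++_)
open import Data.Product using (Σ; ∃; _×_; _,_)
open import Relation.Binary.PropositionalEquality using (_≡_; _≢_)
open import Relation.Nullary using (yes; no)
open import Function.Bundles using (_⇔_)

-- Configurations of {0,1}^ℤ (0 = false, 1 = true)
Config : Set
Config = ℤ → Bool

bit : ℕ → ℕ → Bool
bit N zero with N % 2
... | zero = false
... | suc _ = true
bit N (suc k) = bit (N / 2) k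

toℕB : Bool → ℕ
toℕB false = 0
toℕB true = 1

localRule : ℕ → Bool → Bool → Bool → Bool
localRule N a b c = bit N (4 ℕ.* toℕB a ℕ.+ 2 ℕ.* toℕB b ℕ.+ toℕB c)

ECA : ℕ → Config → Config
ECA N x i = localRule N (x (i ℤ.- ℤ.1ℤ)) (x i) (x (i ℤ.+ ℤ.1ℤ))

iter : {A : Set} → (A → A) → ℕ → A → A
iter f zero a = a
iter f (suc t) a = f (iter f t a)

periodic : {k : ℕ} → Vec Bool (suc k) → Config
periodic {k} u i = lookup u (fromℕ< (n%ℕd<d i (suc k)))

patch : {k m : ℕ} → Vec Bool (suc k) → Vec Bool m → Config
patch {k} {m} u x (+ n) with n ℕ.<? m
... | yes n<m = lookup x (fromℕ< n<m)
... | no _ = periodic u (+ n)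
patch u x -[1+ n ] = periodic u -[1+ n ]

DiffInInterval : ℕ → Config → Config → Set
DiffInInterval w c d = ∃ λ (a : ℤ) → ∀ (i : ℤ) → c i ≢ d i → (a ℤ.≤ i) × (i ℤ.< a ℤ.+ + w)

-- SInv_{F_N,u,n}(x) = 1  iff  this proposition holds
SInv : (N : ℕ) {k : ℕ} (u : Vec Bool (suc k)) {n : ℕ} (x : Vec Bool n) → Set
SInv N u x = ∃ λ (w : ℕ) → ∀ (t : ℕ) →
  DiffInInterval w (iter (ECA N) t (periodic u)) (iter (ECA N) t (patch u x))

data Protocol (X Y Z : Set) : Set where
  leaf  : Z → Protocol X Y Z
  alice : (X → Bool) → Protocol X Y Z → Protocol X Y Z → Protocol X Y Z
  bob   : (Y → Bool) → Protocol X Y Z → Protocol X Y Z → Protocol X Y Z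

run : {X Y Z : Set} → Protocol X Y Z → X → Y → Z
run (leaf z) x y = z
run (alice f l r) x y = if f x then run r x y else run l x y
run (bob g l r) x y = if g y then run r x y else run l x y

depth : {X Y Z : Set} → Protocol X Y Z → ℕ
depth (leaf _) = 0
depth (alice _ l r) = suc (depth l ⊔ depth r)
depth (bob _ l r) = suc (depth l ⊔ depth r)

SInvSplitCC≤ : (N : ℕ) {k : ℕ} (u : Vec Bool (suc k)) (i j c : ℕ) → Set
SInvSplitCC≤ N u i j c =
  Σ (Protocol (Vec Bool i) (Vec Bool j) Bool) λ P →
    (depth P ℕ.≤ c) ×
    (∀ (x : Vec Bool i) (y : Vec Bool j) → (run P x y ≡ true) ⇔ SInv N u (x ++ y))

-- D(SInv_{F_N,u,n}) ≤ c : every split position i (0 ≤ i ≤ n) admits such a protocol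
SInvCC≤ : (N : ℕ) {k : ℕ} (u : Vec Bool (suc k)) (n c : ℕ) → Set
SInvCC≤ N u n c = ∀ (i j : ℕ) → i ℕ.+ j ≡ n → SInvSplitCC≤ N u i j c

module Submission where

-- Rule 156 is f(0,b,c) = b, f(1,b,c) = (b = c). A 0 followed by a 1 is therefore never
-- changed, and such a pair is a wall: cells left of its 1 and cells right of its 0 evolve
-- independently of everything beyond it. If u contains both letters, p_u has a 01 in every
-- period, and walls on either side of the patch confine all differences to a fixed interval,
-- so SInv is constantly true. If u is all 0s and the patch contains a 1, the cell before the
-- first 1 is a wall while the last 1 advances one cell per step into the background, so the
-- differences spread without bound; dually for u all 1s, with the last 0 as wall and the
-- first 0 advancing left. Hence SInv(xy) only asks whether xy is constant equal to the letter
-- of a uniform u, which Alice and Bob decide with one bit each.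

open import Defs
open import Data.Bool using (Bool; true; false; not; _≟_)
open import Data.Bool.Properties using (¬-not; not-¬; not-involutive)
open import Data.Nat as ℕ using (ℕ; zero; suc; z≤n; s≤s; _∸_)
import Data.Nat.Properties as ℕ
open import Data.Nat.DivMod using (_%_; m%n<n; m<n⇒m%n≡m; n%n≡0; [m+n]%n≡m%n)
open import Data.Integer as ℤ using (ℤ; +_; -[1+_]; _+_; _-_; 0ℤ; 1ℤ; -1ℤ; +≤+; +<+)
import Data.Integer.Properties as ℤ
open import Data.Integer.DivMod using (_%ℕ_)
open import Data.Integer.Tactic.RingSolver using (solve-∀)
open import Data.Fin using (toℕ)
import Data.Fin.Properties as Fin
open import Data.Vec using (Vec; lookup; _++_)
open import Data.Vec.Relation.Unary.All using (All; all?; decide)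
open import Data.Vec.Relation.Unary.All.Properties using (lookup⁺; ++⁺; ++ˡ⁻; ++ʳ⁻)
open import Data.Vec.Relation.Unary.Any as Any using (Any)
open import Data.Vec.Relation.Unary.Any.Properties using (lookup-index)
open import Data.Product using (∃; ∃₂; _×_; _,_; proj₁; proj₂)
open import Data.Sum using (_⊎_; inj₁; inj₂)
open import Data.Empty using (⊥-elim)
open import Function.Bundles using (_⇔_; mk⇔)
open import Function.Construct.Composition using (_⇔-∘_)
open import Relation.Nullary using (¬_; yes; no; does; contradiction)
open import Relation.Unary using (Pred; Decidable)
open import Relation.Binary.Definitions using (tri<; tri≈; tri>)
open import Relation.Binary.PropositionalEquality

i+1-1≡i : ∀ i → (i + 1ℤ) - 1ℤ ≡ i
i+1-1≡i = solve-∀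

i-1+1≡i : ∀ i → (i - 1ℤ) + 1ℤ ≡ i
i-1+1≡i = solve-∀

[i-j]+j≡i : ∀ i j → (i - j) + j ≡ i
[i-j]+j≡i = solve-∀

[i+j]+1≡[i+1]+j : ∀ i j → (i + j) + 1ℤ ≡ (i + 1ℤ) + j
[i+j]+1≡[i+1]+j = solve-∀

[i-j]+1≡[i+1]-j : ∀ i j → (i - j) + 1ℤ ≡ (i + 1ℤ) - j
[i-j]+1≡[i+1]-j = solve-∀

i+[1+j]≡[i+j]+1 : ∀ i j → i + (1ℤ + j) ≡ (i + j) + 1ℤ
i+[1+j]≡[i+j]+1 = solve-∀

i-[1+j]≡[i-j]-1 : ∀ i j → i - (1ℤ + j) ≡ (i - j) - 1ℤ
i-[1+j]≡[i-j]-1 = solve-∀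

i≤i+1 : ∀ i → i ℤ.≤ i + 1ℤ
i≤i+1 i = ℤ.i≤i+j i 1ℤ

i-1≤i : ∀ i → i - 1ℤ ℤ.≤ i
i-1≤i i = ℤ.i-j≤i i 1ℤ

i<i+1 : ∀ i → i ℤ.< i + 1ℤ
i<i+1 i = ℤ.suc[i]≤j⇒i<j (ℤ.≤-reflexive (ℤ.+-comm 1ℤ i))

i-1<i : ∀ i → i - 1ℤ ℤ.< i
i-1<i i = subst (i - 1ℤ ℤ.<_) (i-1+1≡i i) (i<i+1 (i - 1ℤ))

i<j⇒i+1≤j : ∀ {i j} → i ℤ.< j → i + 1ℤ ℤ.≤ j
i<j⇒i+1≤j {i} i<j = subst (ℤ._≤ _) (ℤ.+-comm 1ℤ i) (ℤ.i<j⇒suc[i]≤j i<j)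

i<j⇒i≤j-1 : ∀ {i j} → i ℤ.< j → i ℤ.≤ j - 1ℤ
i<j⇒i≤j-1 {i} i<j = subst (ℤ._≤ _) (i+1-1≡i i) (ℤ.+-monoˡ-≤ -1ℤ (i<j⇒i+1≤j i<j))

module _ (d : ℕ) .{{_ : ℕ.NonZero d}} where

  -[1+n]%ℕd : ∀ n → -[1+ n ] %ℕ d ≡ (d ∸ suc n % d) % d
  -[1+n]%ℕd n with suc n % d | m%n<n (suc n) d
  ... | zero  | _   = sym (n%n≡0 d)
  ... | suc r | r<d = sym (m<n⇒m%n≡m (ℕ.∸-monoʳ-< (s≤s z≤n) (ℕ.<⇒≤ r<d)))

  [i+d]%ℕd≡i%ℕd : ∀ i → (i + + d) %ℕ d ≡ i %ℕ d
  [i+d]%ℕd≡i%ℕd (+ n) = [m+n]%n≡m%n n d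
  [i+d]%ℕd≡i%ℕd -[1+ n ] with ℕ.<-cmp (suc n) d
  ... | tri< 1+n<d _ _ rewrite ℤ.⊖-≥ (ℕ.<⇒≤ 1+n<d) | -[1+n]%ℕd n | m<n⇒m%n≡m 1+n<d = refl
  ... | tri≈ _ refl _ rewrite ℤ.n⊖n≡0 d | -[1+n]%ℕd n =
    sym (trans (cong (λ r → (d ∸ r) % d) (n%n≡0 d)) (n%n≡0 d))
  ... | tri> _ _ d<1+n rewrite ℤ.⊖-< d<1+n | ℕ.+-∸-assoc 1 (ℕ.s≤s⁻¹ d<1+n)
                             | -[1+n]%ℕd n | -[1+n]%ℕd (n ∸ d) =
    cong (λ r → (d ∸ r) % d) (trans (sym ([m+n]%n≡m%n (suc (n ∸ d)) d))
                                    (cong (λ m → suc m % d) (ℕ.m∸n+n≡m (ℕ.s≤s⁻¹ d<1+n))))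

∃01-between : ∀ (g : ℕ → Bool) s m → g s ≡ false → g (s ℕ.+ m) ≡ true →
              ∃ λ n → g n ≡ false × g (suc n) ≡ true
∃01-between g s zero gs≡0 gs+0≡1 =
  contradiction (trans (sym gs≡0) (trans (cong g (sym (ℕ.+-identityʳ s))) gs+0≡1)) λ ()
∃01-between g s (suc m) gs≡0 gs+m≡1 with g (suc s) in gs+1
... | true  = s , gs≡0 , gs+1
... | false = ∃01-between g (suc s) m gs+1 (trans (cong g (sym (ℕ.+-suc s m))) gs+m≡1)

least-witness : ∀ {p} {P : Pred ℕ p} → Decidable P → ∀ {l} → P l →
                ∃ λ n → P n × (∀ s → s ℕ.< n → ¬ P s)
least-witness P? {l} Pl with P? 0
... | yes P0 = 0 , P0 , λ _ ()
least-witness P? {zero} P0 | no ¬P0 = contradiction P0 ¬P0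
least-witness P? {suc l} Pl | no ¬P0 with least-witness (λ n → P? (suc n)) Pl
... | n , Pn , below = suc n , Pn , λ where
  zero _ → ¬P0
  (suc s) (s≤s s<n) → below s s<n

greatest-witness : ∀ {p} {P : Pred ℕ p} → Decidable P → ∀ m → (∀ s → m ℕ.≤ s → ¬ P s) →
                   ∀ {l} → P l → ∃ λ n → P n × (∀ s → n ℕ.< s → ¬ P s)
greatest-witness P? zero above Pl = contradiction Pl (above _ z≤n)
greatest-witness {P = P} P? (suc m) above Pl with P? m
... | yes Pm = m , Pm , above
... | no ¬Pm = greatest-witness P? m above′ Pl
  where
  above′ : ∀ s → m ℕ.≤ s → ¬ P s
  above′ s m≤s with m ℕ.≟ s
  ... | yes refl = ¬Pm
  ... | no m≢s = above s (ℕ.≤∧≢⇒< m≤s m≢s)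

≡⊎≡not : ∀ b y → y ≡ b ⊎ y ≡ not b
≡⊎≡not b y with y ≟ b
... | yes y≡b = inj₁ y≡b
... | no y≢b = inj₂ (¬-not y≢b)

≢not⇒≡ : ∀ {x b} → x ≢ not b → x ≡ b
≢not⇒≡ {b = b} x≢not-b = trans (¬-not x≢not-b) (not-involutive b)

-- Locality of elementary cellular automata

module _ (N : ℕ) where

  private
    F : Config → Config
    F = ECA N

  ECA-cong : ∀ {c d : Config} i → c (i - 1ℤ) ≡ d (i - 1ℤ) → c i ≡ d i →
             c (i + 1ℤ) ≡ d (i + 1ℤ) → F c i ≡ F d i
  ECA-cong i left mid right rewrite left | mid | right = refl

  iter-ECA-cong : ∀ {c d : Config} → (∀ i → c i ≡ d i) → ∀ t i → iter F t c i ≡ iter F t d i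
  iter-ECA-cong c≗d zero i = c≗d i
  iter-ECA-cong {c} {d} c≗d (suc t) i = ECA-cong {iter F t c} {iter F t d} i (IH _) (IH i) (IH _)
    where
    IH : ∀ i → iter F t c i ≡ iter F t d i
    IH = iter-ECA-cong c≗d t

  iter-ECA-uniform : ∀ {c : Config} {b} → localRule N b b b ≡ b → (∀ i → c i ≡ b) →
                     ∀ t i → iter F t c i ≡ b
  iter-ECA-uniform fixed c≡b zero i = c≡b i
  iter-ECA-uniform {c} {b} fixed c≡b (suc t) i =
    trans (ECA-cong {iter F t c} {λ _ → b} i (IH _) (IH i) (IH _)) fixed
    where
    IH : ∀ i → iter F t c i ≡ b
    IH = iter-ECA-uniform fixed c≡b t

  iter-ECA-agree-≤ : ∀ {c d : Config} j → (∀ i → i ℤ.≤ j → c i ≡ d i) →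
    (∀ t → iter F t c j ≡ iter F t d j) → ∀ t i → i ℤ.≤ j → iter F t c i ≡ iter F t d i
  iter-ECA-agree-≤ j agree wall zero i i≤j = agree i i≤j
  iter-ECA-agree-≤ {c} {d} j agree wall (suc t) i i≤j with i ℤ.≟ j
  ... | yes refl = wall (suc t)
  ... | no i≢j = ECA-cong {iter F t c} {iter F t d} i
                   (IH _ (ℤ.≤-trans (i-1≤i i) i≤j)) (IH i i≤j)
                   (IH _ (i<j⇒i+1≤j (ℤ.≤∧≢⇒< i≤j i≢j)))
    where
    IH : ∀ i → i ℤ.≤ j → iter F t c i ≡ iter F t d i
    IH = iter-ECA-agree-≤ j agree wall t

  iter-ECA-agree-≥ : ∀ {c d : Config} j → (∀ i → j ℤ.≤ i → c i ≡ d i) →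
    (∀ t → iter F t c j ≡ iter F t d j) → ∀ t i → j ℤ.≤ i → iter F t c i ≡ iter F t d i
  iter-ECA-agree-≥ j agree wall zero i j≤i = agree i j≤i
  iter-ECA-agree-≥ {c} {d} j agree wall (suc t) i j≤i with j ℤ.≟ i
  ... | yes refl = wall (suc t)
  ... | no j≢i = ECA-cong {iter F t c} {iter F t d} i
                   (IH _ (i<j⇒i≤j-1 (ℤ.≤∧≢⇒< j≤i j≢i))) (IH i j≤i)
                   (IH _ (ℤ.≤-trans j≤i (i≤i+1 i)))
    where
    IH : ∀ i → j ℤ.≤ i → iter F t c i ≡ iter F t d i
    IH = iter-ECA-agree-≥ j agree wall t

DiffInInterval-spread : ∀ {w c d i j} → DiffInInterval w c d → c i ≢ d i → c j ≢ d j →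
                        j ℤ.< i + + w
DiffInInterval-spread {w} (a , inside) ci≢di cj≢dj =
  ℤ.<-≤-trans (proj₂ (inside _ cj≢dj)) (ℤ.+-monoˡ-≤ (+ w) (proj₁ (inside _ ci≢di)))

-- Rule 156: walls and fronts

localRule-156-bbb : ∀ b → localRule 156 b b b ≡ b
localRule-156-bbb false = refl
localRule-156-bbb true  = refl

localRule-156-0bc : ∀ b c → localRule 156 false b c ≡ b
localRule-156-0bc false false = refl
localRule-156-0bc false true  = refl
localRule-156-0bc true  false = refl
localRule-156-0bc true  true  = refl

record Occurs01 (c : Config) (j : ℤ) : Set where
  constructor _,_
  field
    at    : c j ≡ false
    after : c (j + 1ℤ) ≡ true

record IsLastOne (c : Config) (r : ℤ) : Set where
  constructor _,_
  field
    at     : c r ≡ true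
    beyond : ∀ i → r ℤ.< i → c i ≡ false

record IsFirstZero (c : Config) (l : ℤ) : Set where
  constructor _,_
  field
    at     : c l ≡ false
    before : ∀ i → i ℤ.< l → c i ≡ true

Occurs01-transfer : ∀ {c d : Config} {j j′} → c j ≡ d j′ → c (j + 1ℤ) ≡ d (j′ + 1ℤ) →
                    Occurs01 c j → Occurs01 d j′
Occurs01-transfer cj≡dj′ cj+1≡dj′+1 (cj≡0 , cj+1≡1) =
  trans (sym cj≡dj′) cj≡0 , trans (sym cj+1≡dj′+1) cj+1≡1

ECA156-Occurs01 : ∀ {c j} → Occurs01 c j → Occurs01 (ECA 156 c) j
ECA156-Occurs01 {c} {j} (cj≡0 , cj+1≡1) = stays0 , stays1
  where
  stays0 : ECA 156 c j ≡ false
  stays0 rewrite cj≡0 | cj+1≡1 with c (j - 1ℤ)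
  ... | false = refl
  ... | true  = refl
  stays1 : ECA 156 c (j + 1ℤ) ≡ true
  stays1 rewrite i+1-1≡i j | cj≡0 | cj+1≡1 = localRule-156-0bc true (c ((j + 1ℤ) + 1ℤ))

iter-ECA156-Occurs01 : ∀ {c j} → Occurs01 c j → ∀ t → Occurs01 (iter (ECA 156) t c) j
iter-ECA156-Occurs01 occ zero    = occ
iter-ECA156-Occurs01 occ (suc t) = ECA156-Occurs01 (iter-ECA156-Occurs01 occ t)

ECA156-IsLastOne : ∀ {c r} → IsLastOne c r → IsLastOne (ECA 156 c) (r + 1ℤ)
ECA156-IsLastOne {c} {r} (cr≡1 , beyond) = advanced , beyond′
  where
  advanced : ECA 156 c (r + 1ℤ) ≡ true
  advanced rewrite i+1-1≡i r | cr≡1 | beyond (r + 1ℤ) (i<i+1 r)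
                 | beyond ((r + 1ℤ) + 1ℤ) (ℤ.<-trans (i<i+1 r) (i<i+1 _)) = refl
  beyond′ : ∀ i → r + 1ℤ ℤ.< i → ECA 156 c i ≡ false
  beyond′ i r+1<i rewrite beyond (i - 1ℤ) (ℤ.<-≤-trans (i<i+1 r) (i<j⇒i≤j-1 r+1<i))
                        | beyond i (ℤ.<-trans (i<i+1 r) r+1<i) = localRule-156-0bc false (c (i + 1ℤ))

ECA156-IsFirstZero : ∀ {c l} → IsFirstZero c l → IsFirstZero (ECA 156 c) (l - 1ℤ)
ECA156-IsFirstZero {c} {l} (cl≡0 , before) = advanced , before′
  where
  advanced : ECA 156 c (l - 1ℤ) ≡ false
  advanced rewrite i-1+1≡i l | cl≡0 | before (l - 1ℤ) (i-1<i l)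
                 | before ((l - 1ℤ) - 1ℤ) (ℤ.<-trans (i-1<i _) (i-1<i l)) = refl
  before′ : ∀ i → i ℤ.< l - 1ℤ → ECA 156 c i ≡ true
  before′ i i<l-1 rewrite before (i - 1ℤ) (ℤ.<-trans (i-1<i i) (ℤ.<-trans i<l-1 (i-1<i l)))
                        | before i (ℤ.<-trans i<l-1 (i-1<i l))
                        | before (i + 1ℤ) (ℤ.≤-<-trans (i<j⇒i+1≤j i<l-1) (i-1<i l)) = refl

iter-ECA156-IsLastOne : ∀ {c r} → IsLastOne c r → ∀ t →
                        IsLastOne (iter (ECA 156) t c) (r + + t)
iter-ECA156-IsLastOne {r = r} last zero = subst (IsLastOne _) (sym (ℤ.+-identityʳ r)) last
iter-ECA156-IsLastOne {r = r} last (suc t) =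
  subst (IsLastOne _) (sym (i+[1+j]≡[i+j]+1 r (+ t)))
  (ECA156-IsLastOne (iter-ECA156-IsLastOne last t))

iter-ECA156-IsFirstZero : ∀ {c l} → IsFirstZero c l → ∀ t →
                          IsFirstZero (iter (ECA 156) t c) (l - + t)
iter-ECA156-IsFirstZero {l = l} first zero = subst (IsFirstZero _) (sym (ℤ.+-identityʳ l)) first
iter-ECA156-IsFirstZero {l = l} first (suc t) =
  subst (IsFirstZero _) (sym (i-[1+j]≡[i-j]-1 l (+ t)))
  (ECA156-IsFirstZero (iter-ECA156-IsFirstZero first t))

Occurs01-walls⇒DiffInInterval : ∀ {c d : Config} {l r : ℤ} (w : ℕ) → r ℤ.≤ l + + w →
  Occurs01 c l → Occurs01 d l → Occurs01 c r → Occurs01 d r →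
  (∀ i → i ℤ.≤ l + 1ℤ → c i ≡ d i) → (∀ i → r ℤ.≤ i → c i ≡ d i) →
  ∀ t → DiffInInterval w (iter (ECA 156) t c) (iter (ECA 156) t d)
Occurs01-walls⇒DiffInInterval {c} {d} {l} {r} w r≤l+w cl dl cr dr agreeˡ agreeʳ t =
  l , λ i differ → above i differ , below i differ
  where
  wallˡ : ∀ t → iter (ECA 156) t c (l + 1ℤ) ≡ iter (ECA 156) t d (l + 1ℤ)
  wallˡ t = trans (Occurs01.after (iter-ECA156-Occurs01 cl t))
                  (sym (Occurs01.after (iter-ECA156-Occurs01 dl t)))
  wallʳ : ∀ t → iter (ECA 156) t c r ≡ iter (ECA 156) t d r
  wallʳ t = trans (Occurs01.at (iter-ECA156-Occurs01 cr t))
                  (sym (Occurs01.at (iter-ECA156-Occurs01 dr t)))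
  above : ∀ i → iter (ECA 156) t c i ≢ iter (ECA 156) t d i → l ℤ.≤ i
  above i differ with i ℤ.≤? l + 1ℤ
  ... | yes i≤l+1 = ⊥-elim (differ (iter-ECA-agree-≤ 156 (l + 1ℤ) agreeˡ wallˡ t i i≤l+1))
  ... | no i≰l+1 = ℤ.≤-trans (i≤i+1 l) (ℤ.<⇒≤ (ℤ.≰⇒> i≰l+1))
  below : ∀ i → iter (ECA 156) t c i ≢ iter (ECA 156) t d i → i ℤ.< l + + w
  below i differ with r ℤ.≤? i
  ... | yes r≤i = ⊥-elim (differ (iter-ECA-agree-≥ 156 r agreeʳ wallʳ t i r≤i))
  ... | no r≰i = ℤ.<-≤-trans (ℤ.≰⇒> r≰i) r≤l+w

module _ {k : ℕ} (u : Vec Bool (suc k)) where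

  periodic-cong-%ℕ : ∀ {i j} → i %ℕ suc k ≡ j %ℕ suc k → periodic u i ≡ periodic u j
  periodic-cong-%ℕ i≡j = cong (lookup u) (Fin.fromℕ<-cong _ _ i≡j _ _)

  periodic-+period : ∀ i → periodic u (i + + suc k) ≡ periodic u i
  periodic-+period i = periodic-cong-%ℕ {i + + suc k} {i} ([i+d]%ℕd≡i%ℕd (suc k) i)

  periodic-+multiple : ∀ M i → periodic u (i + + (suc k ℕ.* M)) ≡ periodic u i
  periodic-+multiple zero i =
    cong (periodic u) (trans (cong (λ m → i + + m) (ℕ.*-zeroʳ k)) (ℤ.+-identityʳ i))
  periodic-+multiple (suc M) i = begin
    periodic u (i + + (suc k ℕ.* suc M))
      ≡⟨ cong (λ m → periodic u (i + + m)) (ℕ.*-suc (suc k) M) ⟩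
    periodic u (i + (+ suc k + + (suc k ℕ.* M)))
      ≡⟨ cong (periodic u) (sym (ℤ.+-assoc i _ _)) ⟩
    periodic u ((i + + suc k) + + (suc k ℕ.* M))  ≡⟨ periodic-+multiple M (i + + suc k) ⟩
    periodic u (i + + suc k)                      ≡⟨ periodic-+period i ⟩
    periodic u i                                  ∎
    where open ≡-Reasoning

  periodic--multiple : ∀ M i → periodic u (i - + (suc k ℕ.* M)) ≡ periodic u i
  periodic--multiple M i = trans (sym (periodic-+multiple M (i - + (suc k ℕ.* M))))
                                 (cong (periodic u) ([i-j]+j≡i i _))

  periodic-lookup : ∀ idx → periodic u (+ toℕ idx) ≡ lookup u idx
  periodic-lookup idx = cong (lookup u)
    (trans (Fin.fromℕ<-cong _ _ (m<n⇒m%n≡m (Fin.toℕ<n idx)) _ (Fin.toℕ<n idx))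
           (Fin.fromℕ<-toℕ idx _))

  module _ {m : ℕ} (x : Vec Bool m) where

    patch-<0 : ∀ {i} → i ℤ.< 0ℤ → patch u x i ≡ periodic u i
    patch-<0 { -[1+ n ]} _ = refl
    patch-<0 {+ n} (+<+ ())

    patch-≥ : ∀ {i} → + m ℤ.≤ i → patch u x i ≡ periodic u i
    patch-≥ {+ n} (+≤+ m≤n) with n ℕ.<? m
    ... | yes n<m = contradiction m≤n (ℕ.<⇒≱ n<m)
    ... | no _ = refl

    patch-lookup : ∀ idx → patch u x (+ toℕ idx) ≡ lookup x idx
    patch-lookup idx with toℕ idx ℕ.<? m
    ... | yes i<m = cong (lookup x) (Fin.fromℕ<-toℕ idx i<m)
    ... | no i≮m = contradiction (Fin.toℕ<n idx) i≮m

-- A word with both letters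

module _ {k : ℕ} (u : Vec Bool (suc k)) where

  periodic-Occurs01-+multiple : ∀ {j} M → Occurs01 (periodic u) j →
                                Occurs01 (periodic u) (j + + (suc k ℕ.* M))
  periodic-Occurs01-+multiple {j} M = Occurs01-transfer (sym (periodic-+multiple u M j))
    (sym (trans (cong (periodic u) ([i+j]+1≡[i+1]+j j _)) (periodic-+multiple u M (j + 1ℤ))))

  periodic-Occurs01--multiple : ∀ {j} M → Occurs01 (periodic u) j →
                                Occurs01 (periodic u) (j - + (suc k ℕ.* M))
  periodic-Occurs01--multiple {j} M = Occurs01-transfer (sym (periodic--multiple u M j))
    (sym (trans (cong (periodic u) ([i-j]+1≡[i+1]-j j _)) (periodic--multiple u M (j + 1ℤ))))

  periodic-∃Occurs01 : ∀ {i₀ i₁} → lookup u i₀ ≡ false → lookup u i₁ ≡ true →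
                       ∃ λ k₀ → Occurs01 (periodic u) (+ k₀)
  periodic-∃Occurs01 {i₀} {i₁} u₀≡0 u₁≡1
    with ∃01-between (λ n → periodic u (+ n)) (toℕ i₀) (toℕ i₁ ℕ.+ suc k ∸ toℕ i₀)
           (trans (periodic-lookup u i₀) u₀≡0) one-later
    where
    one-later : periodic u (+ (toℕ i₀ ℕ.+ (toℕ i₁ ℕ.+ suc k ∸ toℕ i₀))) ≡ true
    one-later = begin
      periodic u (+ (toℕ i₀ ℕ.+ (toℕ i₁ ℕ.+ suc k ∸ toℕ i₀)))
        ≡⟨ cong (λ n → periodic u (+ n))
                (ℕ.m+[n∸m]≡n (ℕ.≤-trans (ℕ.<⇒≤ (Fin.toℕ<n i₀)) (ℕ.m≤n+m _ _))) ⟩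
      periodic u (+ toℕ i₁ + + suc k)  ≡⟨ periodic-+period u (+ toℕ i₁) ⟩
      periodic u (+ toℕ i₁)            ≡⟨ trans (periodic-lookup u i₁) u₁≡1 ⟩
      true                             ∎
      where open ≡-Reasoning
  ... | n , pn≡0 , pn+1≡1 =
    n , (pn≡0 , trans (cong (λ m → periodic u (+ m)) (ℕ.+-comm n 1)) pn+1≡1)

  Occurs01-periodic⇒SInv : ∀ {k₀} → Occurs01 (periodic u) (+ k₀) →
                           ∀ {m} (x : Vec Bool m) → SInv 156 u x
  Occurs01-periodic⇒SInv {k₀} occ {m} x =
    X ℕ.+ Y , Occurs01-walls⇒DiffInInterval (X ℕ.+ Y) (ℤ.≤-reflexive r≡l+w)
      occˡ (Occurs01-transfer (agreeˡ l (i≤i+1 l)) (agreeˡ (l + 1ℤ) ℤ.≤-refl) occˡ)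
      occʳ (Occurs01-transfer (agreeʳ r ℤ.≤-refl) (agreeʳ (r + 1ℤ) (i≤i+1 r)) occʳ)
      agreeˡ agreeʳ
    where
    -- Shifting by k₀ + 2 periods puts the left wall before position -1, by m periods puts
    -- the right wall after the patch.
    X Y : ℕ
    X = suc k ℕ.* (k₀ ℕ.+ 2)
    Y = suc k ℕ.* m
    l r : ℤ
    l = + k₀ - + X
    r = + k₀ + + Y
    occˡ : Occurs01 (periodic u) l
    occˡ = periodic-Occurs01--multiple (k₀ ℕ.+ 2) occ
    occʳ : Occurs01 (periodic u) r
    occʳ = periodic-Occurs01-+multiple m occ
    l+1<0 : l + 1ℤ ℤ.< 0ℤ
    l+1<0 = subst (ℤ._< 0ℤ) (sym (l+1≡-1-e (+ k₀) (+ (k ℕ.* (k₀ ℕ.+ 2)))))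
                  (ℤ.≤-<-trans (ℤ.i-j≤i -1ℤ (+ (k ℕ.* (k₀ ℕ.+ 2)))) ℤ.-<+)
      where
      l+1≡-1-e : ∀ a e → (a - ((a + + 2) + e)) + 1ℤ ≡ -1ℤ - e
      l+1≡-1-e = solve-∀
    m≤r : + m ℤ.≤ r
    m≤r = +≤+ (ℕ.≤-trans (ℕ.m≤m+n m (k ℕ.* m)) (ℕ.m≤n+m _ k₀))
    r≡l+w : r ≡ l + + (X ℕ.+ Y)
    r≡l+w = sym ([a-x]+[x+y]≡a+y (+ k₀) (+ X) (+ Y))
      where
      [a-x]+[x+y]≡a+y : ∀ a x y → (a - x) + (x + y) ≡ a + y
      [a-x]+[x+y]≡a+y = solve-∀
    agreeˡ : ∀ i → i ℤ.≤ l + 1ℤ → periodic u i ≡ patch u x i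
    agreeˡ i i≤l+1 = sym (patch-<0 u x (ℤ.≤-<-trans i≤l+1 l+1<0))
    agreeʳ : ∀ i → r ℤ.≤ i → periodic u i ≡ patch u x i
    agreeʳ i r≤i = sym (patch-≥ u x (ℤ.≤-trans m≤r r≤i))

-- A uniform word

module _ {k : ℕ} (u : Vec Bool (suc k)) {b : Bool} (u≡b : All (_≡ b) u) where

  periodic-uniform : ∀ i → periodic u i ≡ b
  periodic-uniform i = lookup⁺ u≡b _

  iter-periodic-uniform : ∀ t i → iter (ECA 156) t (periodic u) i ≡ b
  iter-periodic-uniform = iter-ECA-uniform 156 (localRule-156-bbb b) periodic-uniform

  iter-periodic-uniform-≢ : ∀ {c} t i → iter (ECA 156) t c i ≡ not b →
                            iter (ECA 156) t (periodic u) i ≢ iter (ECA 156) t c i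
  iter-periodic-uniform-≢ t i ci≡not-b pi≡ci =
    not-¬ (iter-periodic-uniform t i) (trans pi≡ci ci≡not-b)

  module _ {m : ℕ} (x : Vec Bool m) where

    patch-uniform : All (_≡ b) x → ∀ i → patch u x i ≡ b
    patch-uniform x≡b -[1+ n ] = periodic-uniform -[1+ n ]
    patch-uniform x≡b (+ n) with n ℕ.<? m
    ... | yes n<m = lookup⁺ x≡b _
    ... | no _ = periodic-uniform (+ n)

    SInv-uniform : All (_≡ b) x → SInv 156 u x
    SInv-uniform x≡b = 0 , λ t → 0ℤ , λ i differ → ⊥-elim (differ (iter-ECA-cong 156 same t i))
      where
      same : ∀ i → periodic u i ≡ patch u x i
      same i = trans (periodic-uniform i) (sym (patch-uniform x≡b i))

    private
      Off : Pred ℕ _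
      Off n = patch u x (+ n) ≡ not b

      off? : Decidable Off
      off? n = patch u x (+ n) ≟ not b

      Off-index : (off : Any (_≡ not b) x) → Off (toℕ (Any.index off))
      Off-index off = trans (patch-lookup u x (Any.index off)) (lookup-index off)

    patch-first-off : Any (_≡ not b) x →
      ∃ λ l → patch u x (+ l) ≡ not b × (∀ i → i ℤ.< + l → patch u x i ≡ b)
    patch-first-off off with least-witness off? (Off-index off)
    ... | l , off-l , below = l , off-l , before
      where
      before : ∀ i → i ℤ.< + l → patch u x i ≡ b
      before -[1+ n ] _ = periodic-uniform -[1+ n ]
      before (+ s) (+<+ s<l) = ≢not⇒≡ (below s s<l)

    patch-last-off : Any (_≡ not b) x →
      ∃ λ r → patch u x (+ r) ≡ not b × (∀ i → + r ℤ.< i → patch u x i ≡ b)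
    patch-last-off off with greatest-witness off? m outside (Off-index off)
      where
      outside : ∀ s → m ℕ.≤ s → ¬ Off s
      outside s m≤s = not-¬ (trans (patch-≥ u x (+≤+ m≤s)) (periodic-uniform (+ s)))
    ... | r , off-r , above = r , off-r , after
      where
      after : ∀ i → + r ℤ.< i → patch u x i ≡ b
      after (+ s) (+<+ r<s) = ≢not⇒≡ (above s r<s)

module _ {k : ℕ} (u : Vec Bool (suc k)) {m : ℕ} (x : Vec Bool m) where

  ¬SInv-ones-on-zeros : All (_≡ false) u → Any (_≡ true) x → ¬ SInv 156 u x
  ¬SInv-ones-on-zeros u≡0 some1 (w , confined)
    with patch-first-off u u≡0 x some1 | patch-last-off u u≡0 x some1
  ... | l , ql≡1 , before | r , qr≡1 , beyond = ℕ.<⇒≱ (ℤ.drop‿+<+ r+T<l+w) (ℕ.m≤n+m T r)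
    where
    q : Config
    q = patch u x
    T : ℕ
    T = l ℕ.+ w
    wall : Occurs01 q (+ l - 1ℤ)
    wall = before _ (i-1<i (+ l)) , subst (λ i → q i ≡ true) (sym (i-1+1≡i (+ l))) ql≡1
    stays1 : iter (ECA 156) T q (+ l) ≡ true
    stays1 = subst (λ i → iter (ECA 156) T q i ≡ true) (i-1+1≡i (+ l))
                   (Occurs01.after (iter-ECA156-Occurs01 wall T))
    front : IsLastOne (iter (ECA 156) T q) (+ r + + T)
    front = iter-ECA156-IsLastOne (qr≡1 , beyond) T
    r+T<l+w : + r + + T ℤ.< + l + + w
    r+T<l+w = DiffInInterval-spread (confined T) (iter-periodic-uniform-≢ u u≡0 T _ stays1)
                                    (iter-periodic-uniform-≢ u u≡0 T _ (IsLastOne.at front))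

  ¬SInv-zeros-on-ones : All (_≡ true) u → Any (_≡ false) x → ¬ SInv 156 u x
  ¬SInv-zeros-on-ones u≡1 some0 (w , confined)
    with patch-first-off u u≡1 x some0 | patch-last-off u u≡1 x some0
  ... | l , ql≡0 , before | r , qr≡0 , beyond = ℤ.+≮0 r<0
    where
    q : Config
    q = patch u x
    T : ℕ
    T = l ℕ.+ w
    wall : Occurs01 q (+ r)
    wall = qr≡0 , beyond _ (i<i+1 (+ r))
    front : IsFirstZero (iter (ECA 156) T q) (+ l - + T)
    front = iter-ECA156-IsFirstZero (ql≡0 , before) T
    [a-[a+b]]+b≡0 : ∀ a b → (a - (a + b)) + b ≡ 0ℤ
    [a-[a+b]]+b≡0 = solve-∀
    r<0 : + r ℤ.< 0ℤ
    r<0 = subst (+ r ℤ.<_) ([a-[a+b]]+b≡0 (+ l) (+ w))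
            (DiffInInterval-spread (confined T)
              (iter-periodic-uniform-≢ u u≡1 T _ (IsFirstZero.at front))
              (iter-periodic-uniform-≢ u u≡1 T _ (Occurs01.at (iter-ECA156-Occurs01 wall T))))

  ¬SInv-off : ∀ {b} → All (_≡ b) u → Any (_≡ not b) x → ¬ SInv 156 u x
  ¬SInv-off {false} = ¬SInv-ones-on-zeros
  ¬SInv-off {true}  = ¬SInv-zeros-on-ones

  uniform-All⇔SInv : ∀ {b} → All (_≡ b) u → All (_≡ b) x ⇔ SInv 156 u x
  uniform-All⇔SInv {b} u≡b = mk⇔ (SInv-uniform u u≡b x) only-if
    where
    only-if : SInv 156 u x → All (_≡ b) x
    only-if sinv with decide (≡⊎≡not b) x
    ... | inj₁ x≡b = x≡b
    ... | inj₂ off = contradiction sinv (¬SInv-off u≡b off)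

allEqual : Bool → ∀ {n} → Vec Bool n → Bool
allEqual b v = does (all? (_≟ b) v)

allEqual-protocol : Bool → ∀ {i j} → Protocol (Vec Bool i) (Vec Bool j) Bool
allEqual-protocol b = alice (allEqual b) (leaf false) (bob (allEqual b) (leaf false) (leaf true))

run-allEqual-protocol : ∀ b {i j} (x : Vec Bool i) (y : Vec Bool j) →
                        (run (allEqual-protocol b) x y ≡ true) ⇔ All (_≡ b) (x ++ y)
run-allEqual-protocol b x y with all? (_≟ b) x | all? (_≟ b) y
... | yes x≡b | yes y≡b = mk⇔ (λ _ → ++⁺ x≡b y≡b) (λ _ → refl)
... | yes _   | no y≢b  = mk⇔ (λ ()) (λ xy≡b → contradiction (++ʳ⁻ x xy≡b) y≢b)
... | no x≢b  | _       = mk⇔ (λ ()) (λ xy≡b → contradiction (++ˡ⁻ x xy≡b) x≢b)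

proposition12 : ∀ {k : ℕ} (u : Vec Bool (suc k)) →
    ∃₂ λ (c N₀ : ℕ) → ∀ (n : ℕ) → N₀ ℕ.≤ n → SInvCC≤ 156 u n c
proposition12 u = 2 , 0 , λ _ _ i j _ → split-protocol i j
  where
  uniform-protocol : ∀ {b i j} → All (_≡ b) u → SInvSplitCC≤ 156 u i j 2
  uniform-protocol {b} u≡b = allEqual-protocol b , ℕ.≤-refl ,
    λ x y → uniform-All⇔SInv u (x ++ y) u≡b ⇔-∘ run-allEqual-protocol b x y

  split-protocol : ∀ i j → SInvSplitCC≤ 156 u i j 2
  split-protocol i j with decide (≡⊎≡not false) u | decide (≡⊎≡not true) u
  ... | inj₁ u≡0 | _ = uniform-protocol u≡0
  ... | inj₂ _ | inj₁ u≡1 = uniform-protocol u≡1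
  ... | inj₂ some1 | inj₂ some0 = leaf true , z≤n ,
    λ x y → mk⇔ (λ _ → Occurs01-periodic⇒SInv u (proj₂ occ) (x ++ y)) (λ _ → refl)
    where
    occ : ∃ λ k₀ → Occurs01 (periodic u) (+ k₀)
    occ = periodic-∃Occurs01 u (lookup-index some0) (lookup-index some1)
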